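{- In the setting described in the context, if $X\subset A$ is a set of vertices such that every pair of distinct vertices of $X$ has codegree in $H$ at most $\frac{n}{32k^2}$, then $|X|<8k$.
   Context: Setting: Let $0<\beta<1/5$, let $n$ be a positive integer and $k=n^{\beta}$, with $n>2^{20}k^5$. Let $G$ be a graph on $n$ vertices with at least $n^2/k$ edges. Let $G_1$ be the induced subgraph of $G$ obtained by repeatedly deleting a vertex of minimum degree until the remaining graph has minimum degree at least $\frac{n}{2k}$. Let $H$ be a bipartite subgraph of $G_1$ with the maximum possible number of edges, with vertex classes $A$ and $B$ labelled so that $|B|\le |A|$. For vertices $x_1,x_2$ of $H$, $N_H(x_1,x_2)$ denotes the set of vertices of $H$ adjacent to both, and the codegree is $d_H(x_1,x_2)=|N_H(x_1,x_2)|$. -}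

module Defs where

open import Data.Nat using (ℕ; zero; suc)
import Data.Nat as ℕ
open import Data.Integer using (+_)
open import Data.Rational using (ℚ; _/_; _*_; _<_; _≤_; 0ℚ; 1ℚ)
open import Data.Bool using (Bool; true; false)
open import Data.Fin using (Fin; toℕ)
open import Data.Fin.Subset using (Subset; _∈_; _∉_; _∩_; _∪_; _-_; ∣_∣; ⊤; ⊥)
open import Data.Vec using (tabulate)
open import Data.List using (map; allFin)
open import Data.Nat.ListAction using (sum)
open import Data.Product using (Σ; ∃; _×_)
open import Data.Sum using (_⊎_)
open import Data.Empty renaming (⊥ to Empty)
open import Relation.Binary.PropositionalEquality using (_≡_)
open import Relation.Nullary using (¬_)
open import Relation.Nullary.Decidable using (⌊_⌋)
open import Data.Bool using (_∧_; _∨_; if_then_else_)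
open import Data.Vec using (lookup)

record ℝ : Set₁ where
  field
    L U        : ℚ → Set            -- L q  means  q < x ;  U q  means  x < q
    L-inhabited : ∃ L
    U-inhabited : ∃ U
    L-down     : ∀ {p q} → p < q → L q → L p
    U-up       : ∀ {p q} → p < q → U p → U q
    L-round    : ∀ {q} → L q → ∃ λ r → q < r × L r
    U-round    : ∀ {r} → U r → ∃ λ q → q < r × U q
    disjoint   : ∀ {q} → L q → U q → Empty
    located    : ∀ {p q} → p < q → L p ⊎ U q
open ℝ public

ℕ→ℚ : ℕ → ℚ
ℕ→ℚ n = (+ n) / 1

_^ℚ_ : ℚ → ℕ → ℚ
q ^ℚ zero  = 1ℚ
q ^ℚ suc m = q * (q ^ℚ m)

-- Comparisons between a real k > 0 and rational quantities.
-- (Each is the literal meaning of the displayed real inequality for k > 0,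
--  c ≥ 0, read through the cuts of k.)

_<ʳ_ : ℚ → ℝ → Set
q <ʳ k = L k q

-- a ≤ c · k   (holds iff a ≤ c·q for every rational q > k)
_≤_·ʳ_ : ℚ → ℚ → ℝ → Set
a ≤ c ·ʳ k = ∀ q → U k q → a ≤ c * q

-- a < c · k   (holds iff a < c·q for some rational q < k)
_<_·ʳ_ : ℚ → ℚ → ℝ → Set
a < c ·ʳ k = ∃ λ q → L k q × a < c * q

-- c · k^m ≤ a   (for k > 0: holds iff c·q^m ≤ a for every rational 0 ≤ q < k)
_·_^ʳ_≤_ : ℚ → ℝ → ℕ → ℚ → Set
c · k ^ʳ m ≤ a = ∀ q → L k q → 0ℚ ≤ q → c * (q ^ℚ m) ≤ a

-- c · k^m < a   (for k > 0: holds iff c·q^m < a for some rational q > k)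
_·_^ʳ_<_ : ℚ → ℝ → ℕ → ℚ → Set
c · k ^ʳ m < a = ∃ λ q → U k q × c * (q ^ℚ m) < a

record Graph (n : ℕ) : Set where
  field
    adj   : Fin n → Fin n → Bool
    sym   : ∀ i j → adj i j ≡ adj j i
    irrefl : ∀ i → adj i i ≡ false
open Graph public

nbhd : ∀ {n} → Graph n → Fin n → Subset n
nbhd G v = tabulate (adj G v)

edgeCount : ∀ {n} → Graph n → ℕ
edgeCount {n} G =
  sum (map (λ i → ∣ tabulate (λ j → ⌊ toℕ i ℕ.<? toℕ j ⌋ ∧ adj G i j) ∣) (allFin n))

degIn : ∀ {n} → Graph n → Subset n → Fin n → ℕ
degIn G S v = ∣ S ∩ nbhd G v ∣

-- "d ≥ n / (2k)", i.e.  n ≤ 2d · k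
DegAtLeast : ℕ → ℝ → ℕ → Set
DegAtLeast n k d = ℕ→ℚ n ≤ ℕ→ℚ (2 ℕ.* d) ·ʳ k

-- Runs of the process "repeatedly delete a vertex of minimum degree while
-- the remaining graph has minimum degree < n/(2k)".  Peel G k S : the vertex
-- set S is reachable by such a run.
data Peel {n : ℕ} (G : Graph n) (k : ℝ) : Subset n → Set where
  start : Peel G k ⊤
  step  : ∀ {S} v → Peel G k S → v ∈ S →
          (∀ u → u ∈ S → degIn G S v ℕ.≤ degIn G S u) →
          ¬ DegAtLeast n k (degIn G S v) →
          Peel G k (S - v)

-- S is the vertex set of G₁: the end result of the deletion process
-- (minimum degree of G[S] is at least n/(2k)).
IsG₁ : ∀ {n} → Graph n → ℝ → Subset n → Set
IsG₁ {n} G k S = Peel G k S × (∀ u → u ∈ S → DegAtLeast n k (degIn G S u))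

IsBipartition : ∀ {n} → Subset n → Subset n → Subset n → Set
IsBipartition S A B = (A ∪ B ≡ S) × (∀ v → v ∈ A → v ∈ B → Empty)

hAdj : ∀ {n} → Graph n → Subset n → Subset n → Fin n → Fin n → Bool
hAdj G A B u w = adj G u w ∧ ((lookup A u ∧ lookup B w) ∨ (lookup B u ∧ lookup A w))

cutSize : ∀ {n} → Graph n → Subset n → Subset n → ℕ
cutSize {n} G A B =
  sum (map (λ u → ∣ tabulate (λ w → lookup A u ∧ lookup B w ∧ adj G u w) ∣) (allFin n))

IsMaxBipartite : ∀ {n} → Graph n → Subset n → Subset n → Subset n → Set
IsMaxBipartite {n} G S A B =
  IsBipartition S A B ×
  (∀ (A′ B′ : Subset n) → IsBipartition S A′ B′ → cutSize G A′ B′ ℕ.≤ cutSize G A B)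

codeg : ∀ {n} → Graph n → Subset n → Subset n → Fin n → Fin n → ℕ
codeg G A B x₁ x₂ = ∣ tabulate (λ w → hAdj G A B x₁ w ∧ hAdj G A B x₂ w) ∣

module Submission where

-- 1. By maximality of the cut, each x ∈ A has at least half of its G₁-neighbours in B
--    (maxcut-degree), so d_B(x) ≥ n/4k.
-- 2. Double counting the paths x w y with w ∈ B and distinct x, y in a set Y ⊆ A, and
--    using 2J ≤ 2 + J(J − 1) for the number J of Y-neighbours of w, gives
--    2 ∑_{x∈Y} d_B(x) ≤ 2|B| + ∑_{x≠y∈Y} d_H(x, y)  (Counting.codegree-count).
-- 3. With |B| ≤ n/2 and |Y| = t this reads t/2k ≤ 1 + t(t − 1)/32k², which is false
--    for t ≈ 8k (spread-bound, narrow-window).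
-- The real number k is a Dedekind cut, so steps 1–3 are run with rational bounds on the
-- grid of eighths: either |X|/8 < k, and we are done, or k lies in a window
-- i/8 < k < (i + 2)/8 with 7 ≤ i < |X| (grid-argument), which i vertices of X rule out
-- (no-window).

open import Defs renaming (sym to adj-sym; irrefl to adj-irrefl)
open import Data.Nat using (ℕ; zero; suc; _+_; _*_; _∸_; _^_; _≤_; _<_; _≤?_; z≤n; s≤s; s≤s⁻¹; >-nonZero)
open import Data.Nat.Properties
  using (+-*-semiring; +-mono-≤; +-monoˡ-≤; +-monoʳ-≤; *-monoʳ-≤; +-identityʳ; +-comm; +-cancelˡ-≤; +-cancelʳ-≡; *-assoc; *-monoˡ-≤; *-monoˡ-<; n<1+n; m≤n⇒m≤1+n; m≤n⇒m<n∨m≡n; ≰⇒>; *-identityʳ; <⇒≤; *-cancelˡ-≤; m+1+n≰m;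
         ≤-refl; ≤-trans; ≤-reflexive; m≤o∸n⇒m+n≤o; module ≤-Reasoning)
open import Data.Nat.Tactic.RingSolver using (solve-∀)
open import Data.Bool using (Bool; true; false; _∧_; _∨_; not)
open import Data.Bool.Properties using (∨-identityʳ)
open import Data.Fin using (Fin; zero; suc; _≟_)
open import Data.Fin.Subset using (Subset; _∈_; _⊆_; _∪_; _∩_; ∣_∣; ⊥)
open import Data.Fin.Subset.Properties using (⊥⊆; ∣⊥∣≡0; ∣p∣≤n; s⊆s; p⊆q⇒∣p∣≤∣q∣; ∣∁p∣≡n∸∣p∣; x∉p⇒x∈∁p; x∈p∪q⁺)
open import Data.Vec using (Vec; []; _∷_; lookup; tabulate)
import Data.Vec.Properties as Vec
open import Data.List using (map; allFin)
import Data.List.Properties as List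
import Data.Nat.ListAction as List
import Data.Integer as ℤ
import Data.Integer.Properties as ℤ
open import Data.Rational using (ℚ; _/_; 1ℚ; 0ℚ)
import Data.Rational as ℚ
import Data.Rational.Properties as ℚ
open import Data.Rational.Unnormalised using (mkℚᵘ; _≃_; *≡*; *≤*; *<*)
import Data.Rational.Unnormalised.Properties as ℚᵘ
open import Data.Product using (∃; _×_; _,_; proj₁; proj₂)
open import Data.Sum using (_⊎_; inj₁; inj₂)
open import Data.Empty using (⊥-elim) renaming (⊥ to Empty)
open import Relation.Nullary using (does; yes; no)
open import Relation.Binary.PropositionalEquality
open import Function using (_∘_)
open import Algebra.Properties.Semiring.Sum +-*-semiring
  using (sum-cong-≗; sum-replicate-zero; ∑-distrib-+; ∑-comm; *-distribˡ-sum; *-distribʳ-sum)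
  renaming (sum to ∑)

𝟙 : Bool → ℕ
𝟙 true  = 1
𝟙 false = 0

𝟙-swap : ∀ a b c → 𝟙 a * 𝟙 (b ∧ c) ≡ 𝟙 b * 𝟙 (a ∧ c)
𝟙-swap true  true  c = refl
𝟙-swap true  false c = refl
𝟙-swap false true  c = refl
𝟙-swap false false c = refl

𝟙-guard : ∀ b {m m′} → (b ≡ true → m ≤ m′) → 𝟙 b * m ≤ 𝟙 b * m′
𝟙-guard true  m≤m′ = +-monoˡ-≤ 0 (m≤m′ refl)
𝟙-guard false _    = z≤n

𝟙-∨-∧ : ∀ a b c → 𝟙 ((a ∨ b) ∧ c) ≤ 𝟙 (a ∧ c) + 𝟙 (b ∧ c)
𝟙-∨-∧ true  _     true  = s≤s z≤n
𝟙-∨-∧ false true  true  = s≤s z≤n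
𝟙-∨-∧ false false true  = z≤n
𝟙-∨-∧ true  _     false = z≤n
𝟙-∨-∧ false true  false = z≤n
𝟙-∨-∧ false false false = z≤n

∑² : ∀ {m n} → (Fin m → Fin n → ℕ) → ℕ
∑² f = ∑ (λ u → ∑ (λ w → f u w))

∑-mono : ∀ {n} {f g : Fin n → ℕ} → (∀ i → f i ≤ g i) → ∑ f ≤ ∑ g
∑-mono {zero}  f≤g = z≤n
∑-mono {suc n} f≤g = +-mono-≤ (f≤g zero) (∑-mono (f≤g ∘ suc))

∑-distribʳ : ∀ {n} (f : Fin n → ℕ) c → ∑ f * c ≡ ∑ (λ u → f u * c)
∑-distribʳ f c = *-distribʳ-sum c f

∑-δ : ∀ {n} (x : Fin n) (g : Fin n → ℕ) → ∑ (λ u → 𝟙 (does (u ≟ x)) * g u) ≡ g x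
∑-δ {suc n} zero g = begin
    g zero + 0 + ∑ {n} (λ _ → 0)  ≡⟨ cong (g zero + 0 +_) (sum-replicate-zero n) ⟩
    g zero + 0 + 0                ≡⟨ cong (_+ 0) (+-identityʳ (g zero)) ⟩
    g zero + 0                    ≡⟨ +-identityʳ (g zero) ⟩
    g zero                        ∎
  where open ≡-Reasoning
∑-δ {suc n} (suc x) g = ∑-δ x (g ∘ suc)

∑²-cong : ∀ {m n} {f g : Fin m → Fin n → ℕ} → (∀ u w → f u w ≡ g u w) → ∑² f ≡ ∑² g
∑²-cong f≗g = sum-cong-≗ (λ u → sum-cong-≗ (f≗g u))

∑²-distrib-+ : ∀ {m n} (f g : Fin m → Fin n → ℕ) → ∑² (λ u w → f u w + g u w) ≡ ∑² f + ∑² g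
∑²-distrib-+ f g = trans (sum-cong-≗ (λ u → ∑-distrib-+ (f u) (g u))) (∑-distrib-+ (∑ ∘ f) (∑ ∘ g))

∑²-distribʳ : ∀ {m n} (f : Fin m → Fin n → ℕ) c → ∑² f * c ≡ ∑² (λ u w → f u w * c)
∑²-distribʳ f c = trans (∑-distribʳ (∑ ∘ f) c) (sum-cong-≗ (λ u → ∑-distribʳ (f u) c))

∑²-δ₁ : ∀ {m n} (x : Fin m) (g : Fin m → Fin n → ℕ) → ∑² (λ u w → 𝟙 (does (u ≟ x)) * g u w) ≡ ∑ (g x)
∑²-δ₁ x g = trans (sum-cong-≗ (λ u → sym (*-distribˡ-sum (𝟙 (does (u ≟ x))) (g u)))) (∑-δ x (∑ ∘ g))

∑²-δ₂ : ∀ {m n} (x : Fin n) (g : Fin m → Fin n → ℕ) → ∑² (λ u w → 𝟙 (does (w ≟ x)) * g u w) ≡ ∑ (λ u → g u x)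
∑²-δ₂ x g = sum-cong-≗ (λ u → ∑-δ x (g u))

∈⇒lookup : ∀ {n} {x : Fin n} {p : Subset n} → x ∈ p → lookup p x ≡ true
∈⇒lookup = Vec.[]=⇒lookup

lookup⇒∈ : ∀ {n} {x : Fin n} {p : Subset n} → lookup p x ≡ true → x ∈ p
lookup⇒∈ {x = x} {p} = Vec.lookup⇒[]= x p

lookup-∪ : ∀ {n} (A B : Subset n) i → lookup (A ∪ B) i ≡ (lookup A i ∨ lookup B i)
lookup-∪ A B i = Vec.lookup-zipWith _∨_ i A B

∈tabulate : ∀ {n} (f : Fin n → Bool) {x} → x ∈ tabulate f → f x ≡ true
∈tabulate f {x} x∈f = trans (sym (Vec.lookup∘tabulate f x)) (∈⇒lookup x∈f)

vec-ext : ∀ {n} {xs ys : Vec Bool n} → (∀ i → lookup xs i ≡ lookup ys i) → xs ≡ ys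
vec-ext {xs = xs} {ys} eq =
  trans (sym (Vec.tabulate∘lookup xs)) (trans (Vec.tabulate-cong eq) (Vec.tabulate∘lookup ys))

∣tabulate∣ : ∀ {n} (f : Fin n → Bool) → ∣ tabulate f ∣ ≡ ∑ (𝟙 ∘ f)
∣tabulate∣ {zero}  f = refl
∣tabulate∣ {suc n} f with f zero
... | true  = cong suc (∣tabulate∣ (f ∘ suc))
... | false = ∣tabulate∣ (f ∘ suc)

∣_∣≡∑ : ∀ {n} (p : Subset n) → ∣ p ∣ ≡ ∑ (𝟙 ∘ lookup p)
∣ []        ∣≡∑ = refl
∣ true ∷ p  ∣≡∑ = cong suc ∣ p ∣≡∑
∣ false ∷ p ∣≡∑ = ∣ p ∣≡∑

listSum≡∑ : ∀ {n} (f : Fin n → ℕ) → List.sum (map f (allFin n)) ≡ ∑ f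
listSum≡∑ {n} f = trans (cong List.sum (List.map-tabulate (λ i → i) f)) (tabulate-sum f)
  where
  tabulate-sum : ∀ {n} (f : Fin n → ℕ) → List.sum (Data.List.tabulate f) ≡ ∑ f
  tabulate-sum {zero}  f = refl
  tabulate-sum {suc n} f = cong (f zero +_) (tabulate-sum (f ∘ suc))

subset-of-size : ∀ {n} (X : Subset n) t → t ≤ ∣ X ∣ → ∃ λ Y → Y ⊆ X × ∣ Y ∣ ≡ t
subset-of-size {n} X zero _ = ⊥ , ⊥⊆ , ∣⊥∣≡0 n
subset-of-size (false ∷ X) (suc t) t<∣X∣ with subset-of-size X (suc t) t<∣X∣
... | Y , Y⊆X , ∣Y∣≡t = false ∷ Y , s⊆s Y⊆X , ∣Y∣≡t
subset-of-size (true ∷ X) (suc t) (s≤s t≤∣X∣) with subset-of-size X t t≤∣X∣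
... | Y , Y⊆X , ∣Y∣≡t = true ∷ Y , s⊆s Y⊆X , cong suc ∣Y∣≡t

other-class : ∀ {n} {S A B : Subset n} → IsBipartition S A B → ∀ {x} → lookup A x ≡ true → lookup B x ≡ false
other-class {B = B} (_ , disjoint) {x} Ax with lookup B x in Bx
... | true  = ⊥-elim (disjoint x (lookup⇒∈ Ax) (lookup⇒∈ Bx))
... | false = refl

smaller-class : ∀ {n} {S A B : Subset n} → IsBipartition S A B → ∣ B ∣ ≤ ∣ A ∣ → 2 * ∣ B ∣ ≤ n
smaller-class {n} {A = A} {B} (_ , disjoint) ∣B∣≤∣A∣ = begin
    2 * ∣ B ∣              ≡⟨ cong (∣ B ∣ +_) (+-identityʳ ∣ B ∣) ⟩
    ∣ B ∣ + ∣ B ∣          ≤⟨ +-monoʳ-≤ ∣ B ∣ ∣B∣≤∣A∣ ⟩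
    ∣ B ∣ + ∣ A ∣          ≤⟨ m≤o∸n⇒m+n≤o ∣ B ∣ (∣p∣≤n A) B≤n-A ⟩
    n                      ∎
  where
  open ≤-Reasoning
  B≤n-A : ∣ B ∣ ≤ n ∸ ∣ A ∣
  B≤n-A = subst (∣ B ∣ ≤_) (∣∁p∣≡n∸∣p∣ A) (p⊆q⇒∣p∣≤∣q∣ (λ x∈B → x∉p⇒x∈∁p (λ x∈A → disjoint _ x∈A x∈B)))

cross : ∀ {n} → Graph n → (Fin n → Bool) → (Fin n → Bool) → ℕ
cross G P Q = ∑² (λ u w → 𝟙 (P u ∧ Q w ∧ adj G u w))

degTo : ∀ {n} → Graph n → (Fin n → Bool) → Fin n → ℕ
degTo G P x = ∑ (λ w → 𝟙 (P w ∧ adj G x w))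

cutSize≡cross : ∀ {n} (G : Graph n) (A B : Subset n) → cutSize G A B ≡ cross G (lookup A) (lookup B)
cutSize≡cross {n} G A B =
  trans (listSum≡∑ {n} _) (sum-cong-≗ (λ u → ∣tabulate∣ (λ w → lookup A u ∧ lookup B w ∧ adj G u w)))

degIn≡degTo : ∀ {n} (G : Graph n) (P : Subset n) (x : Fin n) → degIn G P x ≡ degTo G (lookup P) x
degIn≡degTo G P x = trans ∣ P ∩ nbhd G x ∣≡∑ (sum-cong-≗ (λ w → cong 𝟙 (lookup-∩ w)))
  where
  lookup-∩ : ∀ w → lookup (P ∩ nbhd G x) w ≡ (lookup P w ∧ adj G x w)
  lookup-∩ w = trans (Vec.lookup-zipWith _∧_ w P (nbhd G x))
                     (cong (lookup P w ∧_) (Vec.lookup∘tabulate (adj G x) w))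

remove insert : ∀ {n} → (Fin n → Bool) → Fin n → Fin n → Bool
remove P x u = P u ∧ not (does (u ≟ x))
insert Q x w = Q w ∨ does (w ≟ x)

move-identity : ∀ {n} (G : Graph n) (P Q : Fin n → Bool) (x : Fin n) → P x ≡ true → Q x ≡ false →
                cross G (remove P x) (insert Q x) + degTo G Q x ≡ cross G P Q + degTo G P x
move-identity G P Q x Px Qx = begin
    cross G P⁻ Q⁺ + degTo G Q x
  ≡⟨ cong (cross G P⁻ Q⁺ +_) (sym (∑²-δ₁ x (λ u w → 𝟙 (Q w ∧ adj G u w)))) ⟩
    cross G P⁻ Q⁺ + ∑² (λ u w → 𝟙 (does (u ≟ x)) * 𝟙 (Q w ∧ adj G u w))
  ≡⟨ sym (∑²-distrib-+ (λ u w → 𝟙 (P⁻ u ∧ Q⁺ w ∧ adj G u w)) (λ u w → 𝟙 (does (u ≟ x)) * 𝟙 (Q w ∧ adj G u w))) ⟩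
    ∑² (λ u w → 𝟙 (P⁻ u ∧ Q⁺ w ∧ adj G u w) + 𝟙 (does (u ≟ x)) * 𝟙 (Q w ∧ adj G u w))
  ≡⟨ ∑²-cong pointwise ⟩
    ∑² (λ u w → 𝟙 (P u ∧ Q w ∧ adj G u w) + 𝟙 (does (w ≟ x)) * 𝟙 (P u ∧ adj G u w))
  ≡⟨ ∑²-distrib-+ (λ u w → 𝟙 (P u ∧ Q w ∧ adj G u w)) (λ u w → 𝟙 (does (w ≟ x)) * 𝟙 (P u ∧ adj G u w)) ⟩
    cross G P Q + ∑² (λ u w → 𝟙 (does (w ≟ x)) * 𝟙 (P u ∧ adj G u w))
  ≡⟨ cong (cross G P Q +_) (∑²-δ₂ x (λ u w → 𝟙 (P u ∧ adj G u w))) ⟩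
    cross G P Q + ∑ (λ u → 𝟙 (P u ∧ adj G u x))
  ≡⟨ cong (cross G P Q +_) (sum-cong-≗ (λ u → cong (λ b → 𝟙 (P u ∧ b)) (adj-sym G u x))) ⟩
    cross G P Q + degTo G P x
  ∎
  where
  open ≡-Reasoning
  P⁻ Q⁺ : _
  P⁻ = remove P x
  Q⁺ = insert Q x
  pointwise : ∀ u w →
    𝟙 (P⁻ u ∧ Q⁺ w ∧ adj G u w) + 𝟙 (does (u ≟ x)) * 𝟙 (Q w ∧ adj G u w) ≡
    𝟙 (P u ∧ Q w ∧ adj G u w) + 𝟙 (does (w ≟ x)) * 𝟙 (P u ∧ adj G u w)
  pointwise u w with u ≟ x | w ≟ x
  ... | yes refl | yes refl rewrite Px | Qx | adj-irrefl G x = refl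
  ... | yes refl | no _     rewrite Px = refl
  ... | no _     | yes refl rewrite Qx with P u
  ...   | true  = refl
  ...   | false = refl
  pointwise u w | no _ | no _ rewrite ∨-identityʳ (Q w) with P u
  ...   | true  = refl
  ...   | false = refl

move-bipartition : ∀ {n} {S A B : Subset n} {x} → IsBipartition S A B → lookup A x ≡ true →
                   IsBipartition S (tabulate (remove (lookup A) x)) (tabulate (insert (lookup B) x))
move-bipartition {S = S} {A} {B} {x} bip@(A∪B≡S , disjoint) Ax =
  trans (vec-ext same-union) A∪B≡S , still-disjoint
  where
  A⁻ B⁺ : Subset _
  A⁻ = tabulate (remove (lookup A) x)
  B⁺ = tabulate (insert (lookup B) x)
  Bx = other-class bip Ax
  same-union : ∀ i → lookup (A⁻ ∪ B⁺) i ≡ lookup (A ∪ B) i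
  same-union i rewrite lookup-∪ A⁻ B⁺ i | lookup-∪ A B i
                     | Vec.lookup∘tabulate (remove (lookup A) x) i
                     | Vec.lookup∘tabulate (insert (lookup B) x) i with i ≟ x
  ... | yes refl rewrite Ax | Bx = refl
  ... | no _ rewrite ∨-identityʳ (lookup B i) with lookup A i
  ...   | true  = refl
  ...   | false = refl
  still-disjoint : ∀ v → v ∈ A⁻ → v ∈ B⁺ → Empty
  still-disjoint v v∈A⁻ v∈B⁺
    with lookup A v in Av | lookup B v in Bv | v ≟ x | ∈tabulate (remove (lookup A) x) v∈A⁻
       | ∈tabulate (insert (lookup B) x) v∈B⁺
  ... | true  | true  | _        | _  | _  = disjoint v (lookup⇒∈ Av) (lookup⇒∈ Bv)
  ... | true  | false | no _     | _  | ()
  ... | true  | false | yes refl | () | _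
  ... | false | _     | _        | () | _

degree-split : ∀ {n} (G : Graph n) {S A B : Subset n} → A ∪ B ≡ S → ∀ x →
               degIn G S x ≤ degTo G (lookup A) x + degTo G (lookup B) x
degree-split G {S} {A} {B} refl x = begin
    degIn G (A ∪ B) x
  ≡⟨ degIn≡degTo G (A ∪ B) x ⟩
    ∑ (λ w → 𝟙 (lookup (A ∪ B) w ∧ adj G x w))
  ≡⟨ sum-cong-≗ (λ w → cong (λ b → 𝟙 (b ∧ adj G x w)) (lookup-∪ A B w)) ⟩
    ∑ (λ w → 𝟙 ((lookup A w ∨ lookup B w) ∧ adj G x w))
  ≤⟨ ∑-mono (λ w → 𝟙-∨-∧ (lookup A w) (lookup B w) (adj G x w)) ⟩
    ∑ (λ w → 𝟙 (lookup A w ∧ adj G x w) + 𝟙 (lookup B w ∧ adj G x w))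
  ≡⟨ ∑-distrib-+ (λ w → 𝟙 (lookup A w ∧ adj G x w)) (λ w → 𝟙 (lookup B w ∧ adj G x w)) ⟩
    degTo G (lookup A) x + degTo G (lookup B) x
  ∎
  where open ≤-Reasoning

-- In a maximum cut (A, B) of G[S], every vertex of A has at least half of its
-- G[S]-neighbours in B: otherwise moving it to B would enlarge the cut.
maxcut-degree : ∀ {n} (G : Graph n) (S A B : Subset n) → IsMaxBipartite G S A B →
                ∀ x → x ∈ A → degIn G S x ≤ 2 * degIn G B x
maxcut-degree G S A B (bip@(A∪B≡S , _) , maximal) x x∈A = begin
    degIn G S x
  ≤⟨ degree-split G A∪B≡S x ⟩
    degTo G (lookup A) x + degTo G (lookup B) x
  ≤⟨ +-monoˡ-≤ (degTo G (lookup B) x) toA≤toB ⟩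
    degTo G (lookup B) x + degTo G (lookup B) x
  ≡⟨ cong (λ d → d + d) (sym (degIn≡degTo G B x)) ⟩
    degIn G B x + degIn G B x
  ≡⟨ cong (degIn G B x +_) (sym (+-identityʳ _)) ⟩
    2 * degIn G B x
  ∎
  where
  open ≤-Reasoning
  Ax = ∈⇒lookup x∈A
  A⁻ = remove (lookup A) x
  B⁺ = insert (lookup B) x
  smaller-cut : cross G A⁻ B⁺ ≤ cross G (lookup A) (lookup B)
  smaller-cut = subst₂ _≤_
    (trans (cutSize≡cross G (tabulate A⁻) (tabulate B⁺))
           (∑²-cong (λ u w → cong₂ (λ a b → 𝟙 (a ∧ b ∧ adj G u w))
                                   (Vec.lookup∘tabulate A⁻ u) (Vec.lookup∘tabulate B⁺ w))))
    (cutSize≡cross G A B)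
    (maximal (tabulate A⁻) (tabulate B⁺) (move-bipartition bip Ax))
  toA≤toB : degTo G (lookup A) x ≤ degTo G (lookup B) x
  toA≤toB = +-cancelˡ-≤ (cross G (lookup A) (lookup B)) _ _ (begin
      cross G (lookup A) (lookup B) + degTo G (lookup A) x
    ≡⟨ sym (move-identity G (lookup A) (lookup B) x Ax (other-class bip Ax)) ⟩
      cross G A⁻ B⁺ + degTo G (lookup B) x
    ≤⟨ +-monoˡ-≤ (degTo G (lookup B) x) smaller-cut ⟩
      cross G (lookup A) (lookup B) + degTo G (lookup B) x
    ∎)

distinct : ∀ {n} → (Fin n → Bool) → Fin n → Fin n → Bool
distinct Y x y = Y x ∧ Y y ∧ not (does (x ≟ y))

pairs : ∀ {n} → (Fin n → Bool) → ℕ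
pairs Y = ∑² (λ x y → 𝟙 (distinct Y x y))

distinct-sound : ∀ {n} (Y : Fin n → Bool) x y → distinct Y x y ≡ true → Y x ≡ true × Y y ≡ true × x ≢ y
distinct-sound Y x y d with Y x | Y y | x ≟ y
... | true | true | no x≢y = refl , refl , x≢y

pairs-count : ∀ {n} (Y : Fin n → Bool) → pairs Y + ∑ (𝟙 ∘ Y) ≡ ∑ (𝟙 ∘ Y) * ∑ (𝟙 ∘ Y)
pairs-count Y = begin
    pairs Y + ∑ (𝟙 ∘ Y)
  ≡⟨ cong (pairs Y +_) (sym (sum-cong-≗ (λ x → ∑-δ x (𝟙 ∘ Y)))) ⟩
    pairs Y + ∑² (λ x y → 𝟙 (does (y ≟ x)) * 𝟙 (Y y))
  ≡⟨ sym (∑²-distrib-+ (λ x y → 𝟙 (distinct Y x y)) (λ x y → 𝟙 (does (y ≟ x)) * 𝟙 (Y y))) ⟩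
    ∑² (λ x y → 𝟙 (distinct Y x y) + 𝟙 (does (y ≟ x)) * 𝟙 (Y y))
  ≡⟨ ∑²-cong pointwise ⟩
    ∑² (λ x y → 𝟙 (Y x) * 𝟙 (Y y))
  ≡⟨ sum-cong-≗ (λ x → sym (*-distribˡ-sum (𝟙 (Y x)) (𝟙 ∘ Y))) ⟩
    ∑ (λ x → 𝟙 (Y x) * ∑ (𝟙 ∘ Y))
  ≡⟨ sym (*-distribʳ-sum (∑ (𝟙 ∘ Y)) (𝟙 ∘ Y)) ⟩
    ∑ (𝟙 ∘ Y) * ∑ (𝟙 ∘ Y)
  ∎
  where
  open ≡-Reasoning
  pointwise : ∀ x y → 𝟙 (distinct Y x y) + 𝟙 (does (y ≟ x)) * 𝟙 (Y y) ≡ 𝟙 (Y x) * 𝟙 (Y y)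
  pointwise x y with x ≟ y | y ≟ x
  ... | yes refl | no x≢x  = ⊥-elim (x≢x refl)
  ... | no x≢x   | yes refl = ⊥-elim (x≢x refl)
  ... | yes refl | yes _ with Y x
  ...   | true  = refl
  ...   | false = refl
  pointwise x y | no _ | no _ with Y x | Y y
  ... | true  | true  = refl
  ... | true  | false = refl
  ... | false | _     = refl

twice-size≤ : ∀ J P → P + J ≡ J * J → 2 * J ≤ 2 + P
twice-size≤ zero          P _ = z≤n
twice-size≤ (suc zero)    P _ = s≤s (s≤s z≤n)
twice-size≤ (suc (suc m)) P e = begin
    2 * suc (suc m)                     ≡⟨ double (suc m) ⟩
    2 + suc m * 2                       ≤⟨ +-monoʳ-≤ 2 (*-monoʳ-≤ (suc m) (s≤s (s≤s z≤n))) ⟩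
    2 + suc m * suc (suc m)             ≡⟨ cong (2 +_) (sym P≡) ⟩
    2 + P                               ∎
  where
  open ≤-Reasoning
  double : ∀ m → 2 * suc m ≡ 2 + m * 2
  double = solve-∀
  P≡ : P ≡ suc m * suc (suc m)
  P≡ = +-cancelʳ-≡ (suc (suc m)) P _ (trans e (+-comm (suc (suc m)) _))

-- Double counting the edges between a set Y ⊆ A and B, and the paths x w y with
-- w ∈ B and distinct x, y ∈ Y:  2 ∑_{x ∈ Y} d_B(x) ≤ 2|B| + ∑_{x ≠ y ∈ Y} d_H(x, y).
module Counting {n} (G : Graph n) (A B : Subset n) (Y : Fin n → Bool)
                (Y⊆A : ∀ x → Y x ≡ true → lookup A x ≡ true) where

  Yw : Fin n → Fin n → Bool
  Yw w x = Y x ∧ adj G x w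

  degY : Fin n → ℕ
  degY w = ∑ (𝟙 ∘ Yw w)

  degree-sum : ∑ (λ x → 𝟙 (Y x) * degIn G B x) ≡ ∑ (λ w → 𝟙 (lookup B w) * degY w)
  degree-sum = begin
      ∑ (λ x → 𝟙 (Y x) * degIn G B x)
    ≡⟨ sum-cong-≗ (λ x → cong (𝟙 (Y x) *_) (degIn≡degTo G B x)) ⟩
      ∑ (λ x → 𝟙 (Y x) * degTo G (lookup B) x)
    ≡⟨ sum-cong-≗ (λ x → *-distribˡ-sum (𝟙 (Y x)) (λ w → 𝟙 (lookup B w ∧ adj G x w))) ⟩
      ∑² (λ x w → 𝟙 (Y x) * 𝟙 (lookup B w ∧ adj G x w))
    ≡⟨ ∑-comm (λ x w → 𝟙 (Y x) * 𝟙 (lookup B w ∧ adj G x w)) ⟩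
      ∑² (λ w x → 𝟙 (Y x) * 𝟙 (lookup B w ∧ adj G x w))
    ≡⟨ ∑²-cong (λ w x → 𝟙-swap (Y x) (lookup B w) (adj G x w)) ⟩
      ∑² (λ w x → 𝟙 (lookup B w) * 𝟙 (Yw w x))
    ≡⟨ sum-cong-≗ (λ w → sym (*-distribˡ-sum (𝟙 (lookup B w)) (𝟙 ∘ Yw w))) ⟩
      ∑ (λ w → 𝟙 (lookup B w) * degY w)
    ∎
    where open ≡-Reasoning

  common-neighbour : ∀ w x y →
    𝟙 (lookup B w) * 𝟙 (distinct (Yw w) x y) ≤ 𝟙 (distinct Y x y) * 𝟙 (hAdj G A B x w ∧ hAdj G A B y w)
  common-neighbour w x y with lookup B w | Y x in Yx | adj G x w | Y y in Yy | adj G y w | does (x ≟ y)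
  ... | false | _     | _     | _     | _     | _     = z≤n
  ... | true  | false | _     | _     | _     | _     = z≤n
  ... | true  | true  | false | _     | _     | _     = z≤n
  ... | true  | true  | true  | false | _     | _     = z≤n
  ... | true  | true  | true  | true  | false | _     = z≤n
  ... | true  | true  | true  | true  | true  | true  = z≤n
  ... | true  | true  | true  | true  | true  | false rewrite Y⊆A x Yx | Y⊆A y Yy = ≤-refl

  common-neighbours : ∑ (λ w → 𝟙 (lookup B w) * pairs (Yw w)) ≤ ∑² (λ x y → 𝟙 (distinct Y x y) * codeg G A B x y)
  common-neighbours = begin
      ∑ (λ w → 𝟙 (lookup B w) * pairs (Yw w))
    ≡⟨ sum-cong-≗ (λ w → trans (*-distribˡ-sum (𝟙 (lookup B w)) (λ x → ∑ (λ y → 𝟙 (distinct (Yw w) x y))))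
                               (sum-cong-≗ (λ x → *-distribˡ-sum (𝟙 (lookup B w)) (λ y → 𝟙 (distinct (Yw w) x y))))) ⟩
      ∑ (λ w → ∑² (λ x y → F w x y))
    ≡⟨ ∑-comm (λ w x → ∑ (F w x)) ⟩
      ∑ (λ x → ∑ (λ w → ∑ (λ y → F w x y)))
    ≡⟨ sum-cong-≗ (λ x → ∑-comm (λ w y → F w x y)) ⟩
      ∑² (λ x y → ∑ (λ w → F w x y))
    ≤⟨ ∑-mono (λ x → ∑-mono (λ y → ∑-mono (λ w → common-neighbour w x y))) ⟩
      ∑² (λ x y → ∑ (λ w → 𝟙 (distinct Y x y) * 𝟙 (hAdj G A B x w ∧ hAdj G A B y w)))
    ≡⟨ ∑²-cong (λ x y → trans (sym (*-distribˡ-sum (𝟙 (distinct Y x y)) (𝟙 ∘ common x y)))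
                               (cong (𝟙 (distinct Y x y) *_) (sym (∣tabulate∣ (common x y))))) ⟩
      ∑² (λ x y → 𝟙 (distinct Y x y) * codeg G A B x y)
    ∎
    where
    open ≤-Reasoning
    F : Fin n → Fin n → Fin n → ℕ
    F w x y = 𝟙 (lookup B w) * 𝟙 (distinct (Yw w) x y)
    common : Fin n → Fin n → Fin n → Bool
    common x y w = hAdj G A B x w ∧ hAdj G A B y w

  -- the main inequality, from 2J ≤ 2 + J(J − 1) at every w ∈ B
  codegree-count : 2 * ∑ (λ x → 𝟙 (Y x) * degIn G B x) ≤
                   2 * ∣ B ∣ + ∑² (λ x y → 𝟙 (distinct Y x y) * codeg G A B x y)
  codegree-count = begin
      2 * ∑ (λ x → 𝟙 (Y x) * degIn G B x)
    ≡⟨ cong (2 *_) degree-sum ⟩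
      2 * ∑ (λ w → 𝟙 (lookup B w) * degY w)
    ≡⟨ *-distribˡ-sum 2 (λ w → 𝟙 (lookup B w) * degY w) ⟩
      ∑ (λ w → 2 * (𝟙 (lookup B w) * degY w))
    ≤⟨ ∑-mono (λ w → per-vertex (lookup B w) (twice-size≤ (degY w) (pairs (Yw w)) (pairs-count (Yw w)))) ⟩
      ∑ (λ w → 2 * 𝟙 (lookup B w) + 𝟙 (lookup B w) * pairs (Yw w))
    ≡⟨ ∑-distrib-+ (λ w → 2 * 𝟙 (lookup B w)) (λ w → 𝟙 (lookup B w) * pairs (Yw w)) ⟩
      ∑ (λ w → 2 * 𝟙 (lookup B w)) + ∑ (λ w → 𝟙 (lookup B w) * pairs (Yw w))
    ≤⟨ +-mono-≤ (≤-reflexive size-B) common-neighbours ⟩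
      2 * ∣ B ∣ + ∑² (λ x y → 𝟙 (distinct Y x y) * codeg G A B x y)
    ∎
    where
    open ≤-Reasoning
    per-vertex : ∀ b {J P} → 2 * J ≤ 2 + P → 2 * (𝟙 b * J) ≤ 2 * 𝟙 b + 𝟙 b * P
    per-vertex true  {J} {P} le = subst₂ _≤_ (cong (2 *_) (sym (+-identityʳ J))) (cong (2 +_) (sym (+-identityʳ P))) le
    per-vertex false le = z≤n
    size-B : ∑ (λ w → 2 * 𝟙 (lookup B w)) ≡ 2 * ∣ B ∣
    size-B = trans (sym (*-distribˡ-sum 2 (𝟙 ∘ lookup B))) (cong (2 *_) (sym ∣ B ∣≡∑))

combine : ∀ n t j P D C E b → 0 < n → t * (2 * n) ≤ D * j → 2 * D ≤ 2 * b + C → 2 * b ≤ n →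
          C * (P * P) ≤ E * (2 * n) → 4 * t * (P * P) ≤ j * (P * P) + 2 * E * j
combine n t j P D C E b n>0 degrees count half codegrees = *-cancelˡ-≤ n {{>-nonZero n>0}} (begin
    n * (4 * t * (P * P))                  ≡⟨ lemma₁ n t P ⟩
    2 * (t * (2 * n)) * (P * P)            ≤⟨ *-monoˡ-≤ (P * P) (*-monoʳ-≤ 2 degrees) ⟩
    2 * (D * j) * (P * P)                  ≡⟨ lemma₂ D j P ⟩
    (2 * D) * (j * (P * P))                ≤⟨ *-monoˡ-≤ (j * (P * P)) (≤-trans count (+-monoˡ-≤ C half)) ⟩
    (n + C) * (j * (P * P))                ≡⟨ lemma₃ n C j P ⟩
    n * (j * (P * P)) + (C * (P * P)) * j  ≤⟨ +-monoʳ-≤ (n * (j * (P * P))) (*-monoˡ-≤ j codegrees) ⟩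
    n * (j * (P * P)) + (E * (2 * n)) * j  ≡⟨ lemma₄ n E j P ⟩
    n * (j * (P * P) + 2 * E * j)          ∎)
  where
  open ≤-Reasoning
  lemma₁ : ∀ n t P → n * (4 * t * (P * P)) ≡ 2 * (t * (2 * n)) * (P * P)
  lemma₁ = solve-∀
  lemma₂ : ∀ D j P → 2 * (D * j) * (P * P) ≡ (2 * D) * (j * (P * P))
  lemma₂ = solve-∀
  lemma₃ : ∀ n C j P → (n + C) * (j * (P * P)) ≡ n * (j * (P * P)) + (C * (P * P)) * j
  lemma₃ = solve-∀
  lemma₄ : ∀ n E j P → n * (j * (P * P)) + (E * (2 * n)) * j ≡ n * (j * (P * P) + 2 * E * j)
  lemma₄ = solve-∀

spread-bound : ∀ {n} (G : Graph n) (A B : Subset n) → 0 < n → 2 * ∣ B ∣ ≤ n →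
  (Y : Subset n) → Y ⊆ A → ∀ j P →
  (∀ x → x ∈ Y → 2 * n ≤ degIn G B x * j) →
  (∀ x y → x ∈ Y → y ∈ Y → x ≢ y → codeg G A B x y * (P * P) ≤ 2 * n) →
  4 * ∣ Y ∣ * (P * P) ≤ j * (P * P) + 2 * pairs (lookup Y) * j
spread-bound {n} G A B n>0 half Y Y⊆A j P degrees codegrees =
  combine n (∣ Y ∣) j P D C (pairs (lookup Y)) (∣ B ∣) n>0 degree-total codegree-count half codegree-total
  where
  open Counting G A B (lookup Y) (λ x Yx → ∈⇒lookup (Y⊆A (lookup⇒∈ Yx)))
  D C : ℕ
  D = ∑ (λ x → 𝟙 (lookup Y x) * degIn G B x)
  C = ∑² (λ x y → 𝟙 (distinct (lookup Y) x y) * codeg G A B x y)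
  degree-total : ∣ Y ∣ * (2 * n) ≤ D * j
  degree-total = begin
      ∣ Y ∣ * (2 * n)
    ≡⟨ trans (cong (_* (2 * n)) ∣ Y ∣≡∑) (∑-distribʳ (𝟙 ∘ lookup Y) (2 * n)) ⟩
      ∑ (λ x → 𝟙 (lookup Y x) * (2 * n))
    ≤⟨ ∑-mono (λ x → 𝟙-guard (lookup Y x) (λ Yx → degrees x (lookup⇒∈ Yx))) ⟩
      ∑ (λ x → 𝟙 (lookup Y x) * (degIn G B x * j))
    ≡⟨ sum-cong-≗ (λ x → sym (*-assoc (𝟙 (lookup Y x)) (degIn G B x) j)) ⟩
      ∑ (λ x → 𝟙 (lookup Y x) * degIn G B x * j)
    ≡⟨ sym (∑-distribʳ (λ x → 𝟙 (lookup Y x) * degIn G B x) j) ⟩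
      D * j
    ∎
    where open ≤-Reasoning
  codegree-total : C * (P * P) ≤ pairs (lookup Y) * (2 * n)
  codegree-total = begin
      C * (P * P)
    ≡⟨ ∑²-distribʳ (λ x y → 𝟙 (distinct (lookup Y) x y) * codeg G A B x y) (P * P) ⟩
      ∑² (λ x y → 𝟙 (distinct (lookup Y) x y) * codeg G A B x y * (P * P))
    ≤⟨ ∑-mono (λ x → ∑-mono (λ y → bound x y)) ⟩
      ∑² (λ x y → 𝟙 (distinct (lookup Y) x y) * (2 * n))
    ≡⟨ sym (∑²-distribʳ (λ x y → 𝟙 (distinct (lookup Y) x y)) (2 * n)) ⟩
      pairs (lookup Y) * (2 * n)
    ∎
    where
    open ≤-Reasoning
    bound : ∀ x y → 𝟙 (distinct (lookup Y) x y) * codeg G A B x y * (P * P) ≤ 𝟙 (distinct (lookup Y) x y) * (2 * n)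
    bound x y = ≤-trans (≤-reflexive (*-assoc (𝟙 (distinct (lookup Y) x y)) _ _))
      (𝟙-guard (distinct (lookup Y) x y) λ d → let (Yx , Yy , x≢y) = distinct-sound (lookup Y) x y d in
                                             codegrees x y (lookup⇒∈ Yx) (lookup⇒∈ Yy) x≢y)

-- For t = P = i and j = i + 2 (so E = i(i − 1)) the bound of spread-bound fails once
-- i ≥ 3, since 4i³ − (i + 2)i² − 2i(i − 1)(i + 2) = i(i − 2)².
narrow-window : ∀ i E → 3 ≤ i → E + i ≡ i * i → 4 * i * (i * i) ≤ (2 + i) * (i * i) + 2 * E * (2 + i) → Empty
narrow-window .(3 + s) E (s≤s (s≤s (s≤s {n = s} _))) E+i≡i² bound =
  m+1+n≰m (R s) (subst (_≤ R s) (identity s) (subst (λ e → 4 * i * (i * i) ≤ (2 + i) * (i * i) + 2 * e * (2 + i)) E≡ bound))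
  where
  i = 3 + s
  identity : ∀ s → 4 * (3 + s) * ((3 + s) * (3 + s)) ≡
                   (5 + s) * ((3 + s) * (3 + s)) + 2 * ((3 + s) * (2 + s)) * (5 + s) + (3 + s) * ((1 + s) * (1 + s))
  identity = solve-∀
  R : ℕ → ℕ
  R s = (5 + s) * ((3 + s) * (3 + s)) + 2 * ((3 + s) * (2 + s)) * (5 + s)
  E≡ : E ≡ (3 + s) * (2 + s)
  E≡ = +-cancelʳ-≡ i E _ (trans E+i≡i² (square s))
    where
    square : ∀ s → (3 + s) * (3 + s) ≡ (3 + s) * (2 + s) + (3 + s)
    square = solve-∀

-- IsFrac x a c : the rational x equals a / (1 + c).  Products and comparisons of such
-- rationals reduce to products and cross-multiplied comparisons of natural numbers.
IsFrac : ℚ → ℕ → ℕ → Set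
IsFrac x a c = ℚ.toℚᵘ x ≃ mkℚᵘ (ℤ.+ a) c

frac : ∀ a c → IsFrac ((ℤ.+ a) / suc c) a c
frac a c = ℚ.toℚᵘ-fromℚᵘ (mkℚᵘ (ℤ.+ a) c)

frac-* : ∀ {x y a b c d} → IsFrac x a c → IsFrac y b d → IsFrac (x ℚ.* y) (a * b) (d + c * suc d)
frac-* {x} {y} {a} {b} x≐a y≐b =
  ℚᵘ.≃-trans (ℚ.toℚᵘ-homo-* x y) (ℚᵘ.≃-trans (ℚᵘ.*-cong x≐a y≐b) (*≡* (cong₂ ℤ._*_ (sym (ℤ.pos-* a b)) refl)))

frac-≤ : ∀ {x y a b c d} → IsFrac x a c → IsFrac y b d → x ℚ.≤ y → a * suc d ≤ b * suc c
frac-≤ {x} {y} {a} {b} {c} {d} x≐a y≐b x≤y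
  with ℚᵘ.≤-respʳ-≃ y≐b (ℚᵘ.≤-respˡ-≃ x≐a (ℚ.toℚᵘ-mono-≤ x≤y))
... | *≤* ad≤bc = ℤ.drop‿+≤+ (subst₂ ℤ._≤_ (sym (ℤ.pos-* a (suc d))) (sym (ℤ.pos-* b (suc c))) ad≤bc)

≤-frac : ∀ {x y a b c d} → IsFrac x a c → IsFrac y b d → a * suc d ≤ b * suc c → x ℚ.≤ y
≤-frac {a = a} {b} {c} {d} x≐a y≐b ad≤bc =
  ℚ.toℚᵘ-cancel-≤ (ℚᵘ.≤-respʳ-≃ (ℚᵘ.≃-sym y≐b) (ℚᵘ.≤-respˡ-≃ (ℚᵘ.≃-sym x≐a)
    (*≤* (subst₂ ℤ._≤_ (ℤ.pos-* a (suc d)) (ℤ.pos-* b (suc c)) (ℤ.+≤+ ad≤bc)))))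

<-frac : ∀ {x y a b c d} → IsFrac x a c → IsFrac y b d → a * suc d < b * suc c → x ℚ.< y
<-frac {a = a} {b} {c} {d} x≐a y≐b ad<bc =
  ℚ.toℚᵘ-cancel-< (ℚᵘ.<-respʳ-≃ (ℚᵘ.≃-sym y≐b) (ℚᵘ.<-respˡ-≃ (ℚᵘ.≃-sym x≐a)
    (*<* (subst₂ ℤ._<_ (ℤ.pos-* a (suc d)) (ℤ.pos-* b (suc c)) (ℤ.+<+ ad<bc)))))

opaque
  -- The point a/N of the grid of step 1/N, where N = 1 + c.  It is opaque so that grid
  -- points are compared through their coordinates instead of by normalising fractions.
  point : ℕ → ℕ → ℚ
  point c a = (ℤ.+ a) / suc c

  point-frac : ∀ c a → IsFrac (point c a) a c
  point-frac c a = frac a c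

_/8 : ℕ → ℚ
a /8 = point 7 a

point-mono-< : ∀ c {a b} → a < b → point c a ℚ.< point c b
point-mono-< c {a} {b} a<b = <-frac (point-frac c a) (point-frac c b) (*-monoˡ-< (suc c) a<b)

cut-order : ∀ (k : ℝ) {p q} → L k p → U k q → q ℚ.≤ p → Empty
cut-order k Lp Uq q≤p with L-round k Lp
... | r , p<r , Lr = disjoint k Lr (U-up k (ℚ.≤-<-trans q≤p p<r) Uq)

InWindow : ℝ → ℕ → ℕ → Set
InWindow k c i = L k (point c i) × U k (point c (2 + i))

-- If a/N < k < j/N with a + 2 ≤ j, scanning down from j by locatedness finds a window
-- i/N < k < (i + 2)/N with a ≤ i and i + 2 ≤ j.
bracket : ∀ (k : ℝ) c a → L k (point c a) → ∀ j → 2 + a ≤ j → U k (point c j) →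
          ∃ λ i → a ≤ i × 2 + i ≤ j × InWindow k c i
bracket k c a La (suc (suc j)) (s≤s (s≤s a≤j)) U2+j =
  scan (located k (point-mono-< c (n<1+n j))) (m≤n⇒m<n∨m≡n a≤j) (bracket k c a La (suc j))
  where
  Window : ℕ → Set
  Window j = ∃ λ i → a ≤ i × 2 + i ≤ j × InWindow k c i
  scan : L k (point c j) ⊎ U k (point c (suc j)) → a < j ⊎ a ≡ j →
         (2 + a ≤ suc j → U k (point c (suc j)) → Window (suc j)) → Window (suc (suc j))
  scan (inj₁ Lj)   _          _       = j , a≤j , ≤-refl , Lj , U2+j
  scan (inj₂ _)    (inj₂ a≡j) _       = a , ≤-refl , s≤s (s≤s a≤j) , La , subst (λ m → U k (point c (2 + m))) (sym a≡j) U2+j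
  scan (inj₂ U1+j) (inj₁ a<j) descend with descend (s≤s a<j) U1+j
  ... | i , a≤i , 2+i≤1+j , window = i , a≤i , m≤n⇒m≤1+n 2+i≤1+j , window

above-7/8 : ∀ (k : ℝ) → 1ℚ <ʳ k → L k (7 /8)
above-7/8 k k>1 = L-down k (<-frac (point-frac 7 7) (frac 1 0) (s≤s (s≤s (s≤s (s≤s (s≤s (s≤s (s≤s (s≤s z≤n))))))))) k>1

not-below-one : ∀ (k : ℝ) → 1ℚ <ʳ k → ∀ j → j ≤ 8 → U k (j /8) → Empty
not-below-one k k>1 j j≤8 k<j/8 =
  cut-order k k>1 k<j/8 (≤-frac (point-frac 7 j) (frac 1 0) (subst (_≤ 8) (sym (*-identityʳ j)) j≤8))

locate-k : ∀ (k : ℝ) → 1ℚ <ʳ k → ∀ T → L k (T /8) ⊎ ∃ λ i → 7 ≤ i × i < T × InWindow k 7 i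
locate-k k k>1 T with located k (point-mono-< 7 (n<1+n T))
... | inj₁ below = inj₁ below
... | inj₂ above with 9 ≤? suc T
...   | no  T≱8 = ⊥-elim (not-below-one k k>1 (suc T) (s≤s⁻¹ (≰⇒> T≱8)) above)
...   | yes 8≤T with bracket k 7 7 (above-7/8 k k>1) (suc T) 8≤T above
...     | i , 7≤i , 2+i≤1+T , window = inj₂ (i , 7≤i , s≤s⁻¹ 2+i≤1+T , window)

below-eighths : ∀ (k : ℝ) T → L k (T /8) → ℕ→ℚ T < ℕ→ℚ 8 ·ʳ k
below-eighths k T T/8<k with L-round k T/8<k
... | r , T/8<r , r<k = r , r<k , ℚ.≤-<-trans T≤8·T/8 (ℚ.*-monoʳ-<-pos (ℕ→ℚ 8) T/8<r)
  where
  T·8 : ∀ T → T * 8 ≡ 8 * T * 1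
  T·8 = solve-∀
  T≤8·T/8 : ℕ→ℚ T ℚ.≤ ℕ→ℚ 8 ℚ.* (T /8)
  T≤8·T/8 = ≤-frac (frac T 0) (frac-* (frac 8 0) (point-frac 7 T)) (≤-reflexive (T·8 T))

grid-argument : ∀ (k : ℝ) → 1ℚ <ʳ k → ∀ T →
  (∀ i → 3 ≤ i → i ≤ T → InWindow k 7 i → Empty) → ℕ→ℚ T < ℕ→ℚ 8 ·ʳ k
grid-argument k k>1 T no-window with locate-k k k>1 T
... | inj₁ T/8<k = below-eighths k T T/8<k
... | inj₂ (i , 7≤i , i<T , window) =
  ⊥-elim (no-window i (≤-trans (s≤s (s≤s (s≤s z≤n))) 7≤i) (<⇒≤ i<T) window)

-- If k < j/8, every vertex x of A has at least 2n/j neighbours in B, because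
-- n ≤ 2 d_{G₁}(x) k ≤ 2 (2 d_B(x)) j/8.
degree-from-above : ∀ {n} (k : ℝ) (G : Graph n) (S A B : Subset n) →
  (∀ u → u ∈ S → DegAtLeast n k (degIn G S u)) → IsMaxBipartite G S A B →
  ∀ j → U k (j /8) → ∀ x → x ∈ A → 2 * n ≤ degIn G B x * j
degree-from-above {n} k G S A B min-degree maxcut@((A∪B≡S , _) , _) j k<j/8 x x∈A =
  *-cancelˡ-≤ 4 (begin
    4 * (2 * n)            ≡⟨ lemma₁ n ⟩
    n * 8                  ≤⟨ frac-≤ (frac n 0) (frac-* (frac (2 * d) 0) (point-frac 7 j)) (min-degree x x∈S (j /8) k<j/8) ⟩
    2 * d * j * 1          ≤⟨ *-monoˡ-≤ 1 (*-monoˡ-≤ j (*-monoʳ-≤ 2 (maxcut-degree G S A B maxcut x x∈A))) ⟩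
    2 * (2 * dB) * j * 1   ≡⟨ lemma₂ dB j ⟩
    4 * (dB * j)           ∎)
  where
  open ≤-Reasoning
  d dB : ℕ
  d  = degIn G S x
  dB = degIn G B x
  x∈S : x ∈ S
  x∈S = subst (x ∈_) A∪B≡S (x∈p∪q⁺ (inj₁ x∈A))
  lemma₁ : ∀ n → 4 * (2 * n) ≡ n * 8
  lemma₁ = solve-∀
  lemma₂ : ∀ e j → 2 * (2 * e) * j * 1 ≡ 4 * (e * j)
  lemma₂ = solve-∀

-- If P/8 < k, two distinct vertices of X have at most 2n/P² common neighbours in H,
-- because 32 d_H(x, y) (P/8)² ≤ 32 d_H(x, y) k² ≤ n.
codegree-from-below : ∀ {n} (k : ℝ) (G : Graph n) (A B X : Subset n) →
  (∀ x₁ x₂ → x₁ ∈ X → x₂ ∈ X → x₁ ≢ x₂ → ℕ→ℚ (32 * codeg G A B x₁ x₂) · k ^ʳ 2 ≤ ℕ→ℚ n) →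
  ∀ P → L k (P /8) → ∀ x y → x ∈ X → y ∈ X → x ≢ y → codeg G A B x y * (P * P) ≤ 2 * n
codegree-from-below {n} k G A B X sparse P P/8<k x y x∈X y∈X x≢y =
  *-cancelˡ-≤ 32 (begin
    32 * (c * (P * P))             ≡⟨ lemma₁ c P ⟩
    32 * c * (P * (P * 1)) * 1     ≤⟨ frac-≤ 32c·[P/8]² (frac n 0) (sparse x y x∈X y∈X x≢y (P /8) P/8<k 0≤P/8) ⟩
    n * 64                         ≡⟨ lemma₂ n ⟩
    32 * (2 * n)                   ∎)
  where
  open ≤-Reasoning
  c : ℕ
  c = codeg G A B x y
  32c·[P/8]² : IsFrac (ℕ→ℚ (32 * c) ℚ.* ((P /8) ^ℚ 2)) (32 * c * (P * (P * 1))) 63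
  32c·[P/8]² = frac-* (frac (32 * c) 0) (frac-* (point-frac 7 P) (frac-* (point-frac 7 P) (frac 1 0)))
  0≤P/8 : 0ℚ ℚ.≤ P /8
  0≤P/8 = ≤-frac (frac 0 0) (point-frac 7 P) z≤n
  lemma₁ : ∀ c P → 32 * (c * (P * P)) ≡ 32 * c * (P * (P * 1)) * 1
  lemma₁ = solve-∀
  lemma₂ : ∀ n → n * 64 ≡ 32 * (2 * n)
  lemma₂ = solve-∀

-- k cannot lie in a window i/8 < k < (i + 2)/8 with 3 ≤ i ≤ |X|: choosing i vertices
-- of X, spread-bound with t = P = i and j = i + 2 contradicts narrow-window.
no-window : ∀ {n} (k : ℝ) (G : Graph n) (S A B X : Subset n) → 0 < n →
  (∀ u → u ∈ S → DegAtLeast n k (degIn G S u)) → IsMaxBipartite G S A B → ∣ B ∣ ≤ ∣ A ∣ → X ⊆ A →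
  (∀ x₁ x₂ → x₁ ∈ X → x₂ ∈ X → x₁ ≢ x₂ → ℕ→ℚ (32 * codeg G A B x₁ x₂) · k ^ʳ 2 ≤ ℕ→ℚ n) →
  ∀ i → 3 ≤ i → i ≤ ∣ X ∣ → InWindow k 7 i → Empty
no-window k G S A B X n>0 min-degree maxcut@(bip , _) ∣B∣≤∣A∣ X⊆A sparse i 3≤i i≤∣X∣ (i/8<k , k<[2+i]/8) =
  narrow-window i (pairs (lookup Y)) 3≤i pairs-in-Y (subst (λ t → 4 * t * (i * i) ≤ bound) ∣Y∣≡i counting)
  where
  Y : Subset _
  Y = proj₁ (subset-of-size X i i≤∣X∣)
  Y⊆X : Y ⊆ X
  Y⊆X = proj₁ (proj₂ (subset-of-size X i i≤∣X∣))
  ∣Y∣≡i : ∣ Y ∣ ≡ i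
  ∣Y∣≡i = proj₂ (proj₂ (subset-of-size X i i≤∣X∣))
  pairs-in-Y : pairs (lookup Y) + i ≡ i * i
  pairs-in-Y = subst (λ t → pairs (lookup Y) + t ≡ t * t) (trans (sym ∣ Y ∣≡∑) ∣Y∣≡i) (pairs-count (lookup Y))
  bound : ℕ
  bound = (2 + i) * (i * i) + 2 * pairs (lookup Y) * (2 + i)
  counting : 4 * ∣ Y ∣ * (i * i) ≤ bound
  counting = spread-bound G A B n>0 (smaller-class bip ∣B∣≤∣A∣) Y (λ x∈Y → X⊆A (Y⊆X x∈Y)) (2 + i) i
    (λ x x∈Y → degree-from-above k G S A B min-degree maxcut (2 + i) k<[2+i]/8 x (X⊆A (Y⊆X x∈Y)))
    (λ x y x∈Y y∈Y → codegree-from-below k G A B X sparse i i/8<k x y (Y⊆X x∈Y) (Y⊆X y∈Y))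

lemma1 : (n : ℕ) (k : ℝ) → 0 < n →
         1ℚ <ʳ k →
         ℕ→ℚ (2 ^ 20) · k ^ʳ 5 < ℕ→ℚ n →
         (G : Graph n) →
         ℕ→ℚ (n * n) ≤ ℕ→ℚ (edgeCount G) ·ʳ k →
         (S : Subset n) → IsG₁ G k S →
         (A B : Subset n) → IsMaxBipartite G S A B → ∣ B ∣ ≤ ∣ A ∣ →
         (X : Subset n) → X ⊆ A →
         (∀ x₁ x₂ → x₁ ∈ X → x₂ ∈ X → x₁ ≢ x₂ →
            ℕ→ℚ (32 * codeg G A B x₁ x₂) · k ^ʳ 2 ≤ ℕ→ℚ n) →
         ℕ→ℚ ∣ X ∣ < ℕ→ℚ 8 ·ʳ k
lemma1 n k n>0 k>1 _ G _ S (_ , min-degree) A B maxcut ∣B∣≤∣A∣ X X⊆A sparse =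
  grid-argument k k>1 ∣ X ∣ (no-window k G S A B X n>0 min-degree maxcut ∣B∣≤∣A∣ X⊆A sparse)
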